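{- Let $\cong$ be a congruence on LTSs such that $L\doteq L'$ implies $L\cong L'$, and $D\not\cong B$. Then $\cong$ preserves $\mathit{minD}$.
   Context: An LTS is a tuple $L=(S,\Sigma,\Delta,\hat s)$ with states $S$, alphabet $\Sigma$ (possibly infinite), $\tau\notin\Sigma$ a reserved invisible action, transitions $\Delta\subseteq S\times(\Sigma\cup\{\tau\})\times S$, initial state $\hat s$; $\Sigma(L)$ denotes the alphabet. Operators: action prefix $a.L$ ($a\neq\tau$): new initial state $\hat s'$, alphabet $\Sigma\cup\{a\}$, transitions $\Delta\cup\{(\hat s',a,\hat s)\}$. Hiding $L\setminus A$: alphabet $\Sigma\setminus A$, each transition labelled by an element of $A$ relabelled $\tau$, otherwise unchanged. Relational renaming $L\Phi$ ($\Phi$ a set of pairs, $\tau$ not in its domain $\mathcal D(\Phi)$ or range; $\Phi(a,b)$ means $(a,b)\in\Phi$ or $a=b\notin\mathcal D(\Phi)$): alphabet $\{b\mid\exists a\in\Sigma:\Phi(a,b)\}$, transitions $\{(s,b,s')\mid\exists a:(s,a,s')\in\Delta\wedge\Phi(a,b)\}$, same states and initial state. Parallel composition $L_1\|L_2$: states $S_1\times S_2$, alphabet $\Sigma_1\cup\Sigma_2$, initial $(\hat s_1,\hat s_2)$; actions in $\Sigma_1\cap\Sigma_2$ are taken jointly by both components, all other actions (including $\tau$) by one component while the other stays put. A congruence is an equivalence $\cong$ with $L\cong L'\Rightarrow a.L\cong a.L',\ L\setminus A\cong L'\setminus A,\ L\Phi\cong L'\Phi,\ L\|L''\cong L'\|L'',\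 L''\|L\cong L''\|L'$. For $\sigma=a_1\cdots a_n\in\Sigma^*$, $s\stackrel{\sigma}{\Rightarrow}s'$ means a finite path from $s$ to $s'$ whose non-$\tau$ labels are exactly $a_1,\dots,a_n$ in order; $\hat s\stackrel{\xi}{\Rightarrow}$ for $\xi\in\Sigma^\omega$ means an infinite path from $\hat s$ whose non-$\tau$ label sequence is $\xi$; $s\stackrel{\tau^\omega}{\to}$ means an infinite path of $\tau$-transitions from $s$. Define $\mathit{Tr}(L)=\{\sigma\in\Sigma^*\mid\exists s:\hat s\stackrel\sigma\Rightarrow s\}$, $\mathit{Div}(L)=\{\sigma\in\Sigma^*\mid\exists s:\hat s\stackrel\sigma\Rightarrow s\wedge s\stackrel{\tau^\omega}\to\}$, $\mathit{Inf}(L)=\{\xi\in\Sigma^\omega\mid\hat s\stackrel\xi\Rightarrow\}$, $\mathit{Sf}(L)=\{(\sigma,A)\in\Sigma^*\times2^\Sigma\mid\exists s:\hat s\stackrel\sigma\Rightarrow s\wedge\forall a\in A\cup\{\tau\}\,\forall s':(s,a,s')\notin\Delta\}$, and $\mathit{minD}(L)=\{a_1\cdots a_n\in\mathit{Div}(L)\mid\forall i,0\le i<n: a_1\cdots a_i\notin\mathit{Div}(L)\}$ (minimal divergence traces). $L\doteq L'$ (CFFD-equivalence) iff $\Sigma,\mathit{Sf},\mathit{Div},\mathit{Inf}$ all agree on $L$ and $L'$. An equivalence preserves $X$ if $L\cong L'\Rightarrow X(L)=X(L')$. $D$ is the one-state LTS with empty alphabet and no transitions; $B$ is the LTS with empty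 alphabet, states $s_0$ (initial) and $s_1$, and transitions $(s_0,\tau,s_0)$, $(s_0,\tau,s_1)$. -}

module Defs where

open import Level using (Level; _⊔_) renaming (suc to lsuc; zero to 0ℓ)
open import Data.Nat using (ℕ; zero; suc; _<_)
open import Data.List using (List; []; _∷_; length; take)
open import Data.Product using (Σ; ∃; ∃-syntax; _×_; _,_)
open import Data.Sum using (_⊎_; inj₁; inj₂)
open import Data.Maybe using (Maybe; just; nothing)
open import Data.Unit using (⊤; tt)
open import Data.Empty using (⊥)
open import Data.Bool using (Bool; true; false)
open import Relation.Nullary using (¬_)
open import Relation.Binary.PropositionalEquality using (_≡_; refl)
open import Relation.Binary.Structures using (IsEquivalence)
open import Function.Bundles using (_⇔_)

data Label (Act : Set) : Set where
  τ   : Label Act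
  act : Act → Label Act

-- A labelled transition system over the universal action type Act.
-- The alphabet Σ is a subset of Act (a predicate); transitions only carry
-- labels from Σ ∪ {τ} (field Δ-ok).
record LTS (Act : Set) : Set₁ where
  field
    S    : Set
    Sig  : Act → Set
    Δ    : S → Label Act → S → Set
    init : S
    Δ-ok : ∀ s a s' → Δ s (act a) s' → Sig a

module _ {Act : Set} where
  open LTS

  prefix : Act → LTS Act → LTS Act
  prefix a L = record
    { S    = Maybe (S L)
    ; Sig  = λ b → Sig L b ⊎ b ≡ a
    ; Δ    = Δ'
    ; init = nothing
    ; Δ-ok = λ s b s' → ok {s} {b} {s'}
    }
    where
    Δ' : Maybe (S L) → Label Act → Maybe (S L) → Set
    Δ' nothing  l (just s')  = (l ≡ act a) × (s' ≡ init L)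
    Δ' nothing  l nothing    = ⊥
    Δ' (just s) l (just s')  = Δ L s l s'
    Δ' (just s) l nothing    = ⊥
    ok : ∀ {s b s'} → Δ' s (act b) s' → Sig L b ⊎ b ≡ a
    ok {nothing} {b} {just _} (refl , _) = inj₂ refl
    ok {just _} {b} {just _} t = inj₁ (Δ-ok L _ _ _ t)

  hide : LTS Act → (Act → Set) → LTS Act
  hide L A = record
    { S    = S L
    ; Sig  = λ a → Sig L a × ¬ A a
    ; Δ    = Δ'
    ; init = init L
    ; Δ-ok = λ s b s' → ok {s} {b} {s'}
    }
    where
    Δ' : S L → Label Act → S L → Set
    Δ' s l s' =
      ((l ≡ τ) × (Δ L s τ s' ⊎ ∃[ a ] (A a × Δ L s (act a) s')))
      ⊎ ∃[ a ] ((l ≡ act a) × ¬ A a × Δ L s (act a) s')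
    ok : ∀ {s b s'} → Δ' s (act b) s' → Sig L b × ¬ A b
    ok (inj₁ (() , _))
    ok (inj₂ (a , refl , nA , t)) = Δ-ok L _ _ _ t , nA

  RenRel : (Act → Act → Set) → Act → Act → Set
  RenRel Φ a b = Φ a b ⊎ ((a ≡ b) × ¬ (∃[ c ] Φ a c))

  rename : LTS Act → (Act → Act → Set) → LTS Act
  rename L Φ = record
    { S    = S L
    ; Sig  = λ b → ∃[ a ] (Sig L a × RenRel Φ a b)
    ; Δ    = Δ'
    ; init = init L
    ; Δ-ok = λ s b s' → ok {s} {b} {s'}
    }
    where
    Δ' : S L → Label Act → S L → Set
    Δ' s τ s'       = Δ L s τ s'
    Δ' s (act b) s' = ∃[ a ] (Δ L s (act a) s' × RenRel Φ a b)
    ok : ∀ {s b s'} → Δ' s (act b) s' → ∃[ a ] (Sig L a × RenRel Φ a b)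
    ok (a , t , r) = a , Δ-ok L _ _ _ t , r

  data ParΔ (L₁ L₂ : LTS Act) : S L₁ × S L₂ → Label Act → S L₁ × S L₂ → Set where
    τ₁   : ∀ {s₁ s₁' s₂} → Δ L₁ s₁ τ s₁' → ParΔ L₁ L₂ (s₁ , s₂) τ (s₁' , s₂)
    τ₂   : ∀ {s₁ s₂ s₂'} → Δ L₂ s₂ τ s₂' → ParΔ L₁ L₂ (s₁ , s₂) τ (s₁ , s₂')
    sync : ∀ {a s₁ s₁' s₂ s₂'} → Sig L₁ a → Sig L₂ a →
           Δ L₁ s₁ (act a) s₁' → Δ L₂ s₂ (act a) s₂' →
           ParΔ L₁ L₂ (s₁ , s₂) (act a) (s₁' , s₂')
    only₁ : ∀ {a s₁ s₁' s₂} → ¬ Sig L₂ a → Δ L₁ s₁ (act a) s₁' →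
            ParΔ L₁ L₂ (s₁ , s₂) (act a) (s₁' , s₂)
    only₂ : ∀ {a s₁ s₂ s₂'} → ¬ Sig L₁ a → Δ L₂ s₂ (act a) s₂' →
            ParΔ L₁ L₂ (s₁ , s₂) (act a) (s₁ , s₂')

  par : LTS Act → LTS Act → LTS Act
  par L₁ L₂ = record
    { S    = S L₁ × S L₂
    ; Sig  = λ a → Sig L₁ a ⊎ Sig L₂ a
    ; Δ    = ParΔ L₁ L₂
    ; init = init L₁ , init L₂
    ; Δ-ok = λ s b s' → ok {s} {b} {s'}
    }
    where
    ok : ∀ {s a s'} → ParΔ L₁ L₂ s (act a) s' → Sig L₁ a ⊎ Sig L₂ a
    ok (sync x _ _ _) = inj₁ x
    ok (only₁ _ t)    = inj₁ (Δ-ok L₁ _ _ _ t)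
    ok (only₂ _ t)    = inj₂ (Δ-ok L₂ _ _ _ t)

  data WeakTr (L : LTS Act) : S L → List Act → S L → Set where
    done  : ∀ {s} → WeakTr L s [] s
    τstep : ∀ {s s' s'' σ} → Δ L s τ s' → WeakTr L s' σ s'' → WeakTr L s σ s''
    astep : ∀ {s s' s'' a σ} → Δ L s (act a) s' → WeakTr L s' σ s'' →
            WeakTr L s (a ∷ σ) s''

  TauDiv : (L : LTS Act) → S L → Set
  TauDiv L s = Σ (ℕ → S L) λ f → ((f 0 ≡ s) × (∀ i → Δ L (f i) τ (f (suc i))))

  Tr : LTS Act → List Act → Set
  Tr L σ = ∃[ s ] WeakTr L (init L) σ s

  Div : LTS Act → List Act → Set
  Div L σ = ∃[ s ] (WeakTr L (init L) σ s × TauDiv L s)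

  Inf : LTS Act → (ℕ → Act) → Set
  Inf L ξ = Σ (ℕ → S L) λ f → ((f 0 ≡ init L) × (∀ k → WeakTr L (f k) (ξ k ∷ []) (f (suc k))))

  Sf : LTS Act → List Act → (Act → Set) → Set
  Sf L σ A = (∀ a → A a → Sig L a) ×
             ∃[ s ] (WeakTr L (init L) σ s ×
                     (∀ s' → ¬ Δ L s τ s') ×
                     (∀ a → A a → ∀ s' → ¬ Δ L s (act a) s'))

  minD : LTS Act → List Act → Set
  minD L σ = Div L σ × (∀ i → i < length σ → ¬ Div L (take i σ))

  _≐_ : LTS Act → LTS Act → Set₁
  L ≐ L' = (∀ a → Sig L a ⇔ Sig L' a)
         × (∀ σ (A : Act → Set) → Sf L σ A ⇔ Sf L' σ A)
         × (∀ σ → Div L σ ⇔ Div L' σ)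
         × (∀ ξ → Inf L ξ ⇔ Inf L' ξ)

  record IsCongruence {ℓ : Level} (_≅_ : LTS Act → LTS Act → Set ℓ) : Set (lsuc 0ℓ ⊔ ℓ) where
    field
      isEquivalence : IsEquivalence _≅_
      prefix-cong : ∀ {L L'} (a : Act) → L ≅ L' → prefix a L ≅ prefix a L'
      hide-cong   : ∀ {L L'} (A : Act → Set) → L ≅ L' → hide L A ≅ hide L' A
      rename-cong : ∀ {L L'} (Φ : Act → Act → Set) → L ≅ L' → rename L Φ ≅ rename L' Φ
      par-congˡ   : ∀ {L L'} (L'' : LTS Act) → L ≅ L' → par L L'' ≅ par L' L''
      par-congʳ   : ∀ {L L'} (L'' : LTS Act) → L ≅ L' → par L'' L ≅ par L'' L'

  Preserves : {ℓ : Level} (_≅_ : LTS Act → LTS Act → Set ℓ) →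
              (LTS Act → List Act → Set) → Set (lsuc 0ℓ ⊔ ℓ)
  Preserves _≅_ X = ∀ L L' → L ≅ L' → ∀ σ → X L σ ⇔ X L' σ

D : (Act : Set) → LTS Act
D Act = record
  { S = ⊤ ; Sig = λ _ → ⊥ ; Δ = λ _ _ _ → ⊥ ; init = tt ; Δ-ok = λ _ _ _ () }

-- B : states s₀ = false (initial), s₁ = true; transitions (s₀,τ,s₀), (s₀,τ,s₁)
BΔ : {Act : Set} → Bool → Label Act → Bool → Set
BΔ s l s' = (s ≡ false) × (l ≡ τ)

B : (Act : Set) → LTS Act
B Act = record
  { S = Bool ; Sig = λ _ → ⊥ ; Δ = BΔ ; init = false ; Δ-ok = λ { _ _ _ (_ , ()) } }

module Submission where

-- The argument has three layers.
--  (1) Silent systems (empty alphabet).  Up to ≐ such a system is determined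
--      by whether it reaches a stable state and whether it diverges
--      initially.  From X ≅ Y, X diverging and Y not, one builds the chain
--      D ≐ Y ≅ X ≐ X∥B ≅ Y∥B ≐ B, so D ≅ B; hence ≅ transfers initial
--      divergence between silent systems.
--
--  (2) Testers.  Tester ρ offers exactly the word ρ.  The silent context
--      Test ρ X (X synchronised with Tester ρ, everything hidden) diverges
--      iff X diverges after some prefix of ρ, provided ρ uses only X's
--      alphabet.  With (1) this transfers "diverges after a prefix of ρ"
--      along ≅.  A similar context built from a one-action loop shows that
--      ≅ transfers alphabet letters to systems that do not diverge initially.
--
--  (3) σ ∈ minD L iff L diverges after a prefix of σ but after no prefix of
--      a proper prefix of σ; both conditions transfer by (2).
--
-- Excluded middle is used to build infinite τ-paths and to conclude
-- positive facts (divergence, alphabet membership) by contradiction.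

open import Defs
open import Level using (Level)
open import Relation.Nullary using (¬_; yes; no)
open import Axiom.ExcludedMiddle using (ExcludedMiddle)
open import Axiom.DoubleNegationElimination using (em⇒dne)

open import Data.Nat using (ℕ; zero; suc; _+_; _<_; z≤n; s≤s)
open import Data.Nat.Properties using (+-identityʳ; +-suc; <-≤-trans; ≤-refl)
open import Data.List using (List; []; _∷_; _++_; length; take)
open import Data.List.Properties using (++-assoc; ++-identityʳ; length-++-≤ʳ)
open import Data.List.Relation.Unary.All as All using (All; []; _∷_)
open import Data.List.Relation.Unary.All.Properties using (++⁻ˡ; ++⁻ʳ)
open import Data.Product using (Σ; ∃₂; ∃-syntax; _×_; _,_; proj₁; proj₂)
open import Data.Sum using (_⊎_; inj₁; inj₂)
open import Data.Unit using (⊤; tt)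
open import Data.Bool using (true; false)
open import Data.Empty using (⊥; ⊥-elim)
open import Relation.Binary.PropositionalEquality
  using (_≡_; _≢_; refl; sym; trans; cong; subst)
open import Relation.Binary.Structures using (IsEquivalence)
open import Function.Bundles using (_⇔_; mk⇔; Equivalence)

open LTS
open Equivalence using (to; from)

module Theory {Act : Set} where

  WeakTr-snocτ : ∀ {L : LTS Act} {s σ s' s''} →
                 WeakTr L s σ s' → Δ L s' τ s'' → WeakTr L s σ s''
  WeakTr-snocτ done        t = τstep t done
  WeakTr-snocτ (τstep x w) t = τstep x (WeakTr-snocτ w t)
  WeakTr-snocτ (astep x w) t = astep x (WeakTr-snocτ w t)

  WeakTr-++ : ∀ {L : LTS Act} {s σ s' σ' s''} →
              WeakTr L s σ s' → WeakTr L s' σ' s'' → WeakTr L s (σ ++ σ') s''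
  WeakTr-++ done        w' = w'
  WeakTr-++ (τstep x w) w' = τstep x (WeakTr-++ w w')
  WeakTr-++ (astep x w) w' = astep x (WeakTr-++ w w')

  WeakTr-alphabet : ∀ (L : LTS Act) {s σ s'} → WeakTr L s σ s' → All (Sig L) σ
  WeakTr-alphabet L done        = []
  WeakTr-alphabet L (τstep _ w) = WeakTr-alphabet L w
  WeakTr-alphabet L (astep t w) = Δ-ok L _ _ _ t ∷ WeakTr-alphabet L w

  TauDiv-reach : ∀ {L : LTS Act} {s} (p : TauDiv L s) i → WeakTr L s [] (proj₁ p i)
  TauDiv-reach {L} {s} (f , f0 , fs) zero    = subst (WeakTr L s []) (sym f0) done
  TauDiv-reach         p@(f , f0 , fs) (suc i) = WeakTr-snocτ (TauDiv-reach p i) (fs i)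

  TauDiv-from : ∀ {L : LTS Act} {s} (p : TauDiv L s) i → TauDiv L (proj₁ p i)
  TauDiv-from {L} (f , f0 , fs) i =
    (λ k → f (i + k)) , cong f (+-identityʳ i) ,
    λ k → subst (λ j → Δ L (f (i + k)) τ (f j)) (sym (+-suc i k)) (fs (i + k))

  TauDiv-unfold : ∀ {L : LTS Act} (R : S L → Set) →
                  (∀ {s} → R s → ∃[ s' ] (Δ L s τ s' × R s')) →
                  ∀ {s} → R s → TauDiv L s
  TauDiv-unfold {L} R step {s} r = (λ i → proj₁ (path i)) , refl , λ i → proj₁ (proj₂ (step (proj₂ (path i))))
    where
    path : ℕ → Σ (S L) R
    path zero    = s , r
    path (suc i) = let (s' , _ , r') = step (proj₂ (path i)) in s' , r'

  Div-ε-map : ∀ {W V : LTS Act} (h : S W → S V) → h (init W) ≡ init V →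
              (∀ {s s'} → Δ W s τ s' → Δ V (h s) τ (h s')) → Div W [] → Div V []
  Div-ε-map {W} {V} h h-init h-τ (s , w , f , f0 , fs) =
    h s , subst (λ z → WeakTr V z [] (h s)) h-init (reach w) ,
    (λ i → h (f i)) , cong h f0 , λ i → h-τ (fs i)
    where
    reach : ∀ {s s'} → WeakTr W s [] s' → WeakTr V (h s) [] (h s')
    reach done        = done
    reach (τstep t w) = τstep (h-τ t) (reach w)

  Silent : LTS Act → Set
  Silent L = ∀ a → ¬ Sig L a

  ReachesStable : LTS Act → Set
  ReachesStable L = ∃[ s ] (WeakTr L (init L) [] s × (∀ s' → ¬ Δ L s τ s'))

  silent-trace : ∀ {L : LTS Act} → Silent L → ∀ {s σ s'} → WeakTr L s σ s' → σ ≡ []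
  silent-trace e done        = refl
  silent-trace e (τstep _ w) = silent-trace e w
  silent-trace {L} e (astep t _) = ⊥-elim (e _ (Δ-ok L _ _ _ t))

  silent-≐ : ∀ {X Y : LTS Act} → Silent X → Silent Y →
             ReachesStable X ⇔ ReachesStable Y → Div X [] ⇔ Div Y [] → X ≐ Y
  silent-≐ {X} {Y} eX eY st dv =
    (λ a → mk⇔ (λ p → ⊥-elim (eX a p)) (λ p → ⊥-elim (eY a p))) ,
    (λ σ A → mk⇔ (sf eX (to st) σ A) (sf eY (from st) σ A)) ,
    (λ σ → mk⇔ (div eX (to dv) σ) (div eY (from dv) σ)) ,
    (λ ξ → mk⇔ (inf eX ξ) (inf eY ξ))
    where
    sf : ∀ {X Y : LTS Act} → Silent X → (ReachesStable X → ReachesStable Y) →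
         ∀ σ A → Sf X σ A → Sf Y σ A
    sf eX st σ A (A⊆Σ , s , w , stb , _) with silent-trace eX w
    ... | refl = let (s' , w' , stb') = st (s , w , stb)
                 in (λ a Aa → ⊥-elim (eX a (A⊆Σ a Aa))) , s' , w' , stb' ,
                    (λ a Aa → ⊥-elim (eX a (A⊆Σ a Aa)))
    div : ∀ {X Y : LTS Act} → Silent X → (Div X [] → Div Y []) → ∀ σ → Div X σ → Div Y σ
    div eX dv σ d@(_ , w , _) with silent-trace eX w
    ... | refl = dv d
    inf : ∀ {X : LTS Act} {Z : Set} → Silent X → ∀ ξ → Inf X ξ → Z
    inf eX ξ (_ , _ , steps) with silent-trace eX (steps 0)
    ... | ()

  D-silent : Silent (D Act)
  D-silent _ ()

  D-stable : ReachesStable (D Act)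
  D-stable = tt , done , λ _ ()

  D-convergent : ¬ Div (D Act) []
  D-convergent (_ , _ , _ , _ , fs) = fs 0

  B-silent : Silent (B Act)
  B-silent _ ()

  B-stable : ReachesStable (B Act)
  B-stable = true , τstep (refl , refl) done , λ { _ (() , _) }

  B-div : Div (B Act) []
  B-div = init (B Act) , done , (λ _ → init (B Act)) , refl , λ _ → refl , refl

  -- Composing with B adds initial divergence and nothing else.
  par-B-silent : ∀ (X : LTS Act) → Silent X → Silent (par X (B Act))
  par-B-silent X eX a (inj₁ p) = eX a p

  par-B-div : ∀ (X : LTS Act) → Div (par X (B Act)) []
  par-B-div X = init (par X (B Act)) , done , (λ _ → init (par X (B Act))) , refl , λ _ → τ₂ (refl , refl)

  par-B-stable : ∀ {X : LTS Act} → ReachesStable X ⇔ ReachesStable (par X (B Act))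
  par-B-stable {X} = mk⇔ to-par from-par
    where
    XB : LTS Act
    XB = par X (B Act)
    from-par : ReachesStable XB → ReachesStable X
    from-par ((x , b) , w , stb) = x , project w , λ x' t → stb (x' , b) (τ₁ t)
      where
      project : ∀ {s s'} → WeakTr XB s [] s' → WeakTr X (proj₁ s) [] (proj₁ s')
      project done             = done
      project (τstep (τ₁ t) w) = τstep t (project w)
      project (τstep (τ₂ _) w) = project w
    to-par : ReachesStable X → ReachesStable XB
    to-par (x , w , stb) = (x , true) , WeakTr-snocτ (lift w) (τ₂ (refl , refl)) , stable
      where
      lift : ∀ {s s'} → WeakTr X s [] s' → WeakTr XB (s , false) [] (s' , false)
      lift done        = done
      lift (τstep t w) = τstep (τ₁ t) (lift w)
      stable : ∀ s' → ¬ ParΔ X (B Act) (x , true) τ s'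
      stable _ (τ₁ t)       = stb _ t
      stable _ (τ₂ (() , _))

  PrefDivFrom : (X : LTS Act) → S X → List Act → Set
  PrefDivFrom X x r = ∃₂ λ u v → r ≡ u ++ v × ∃[ x' ] (WeakTr X x u x' × TauDiv X x')

  PrefDiv : LTS Act → List Act → Set
  PrefDiv X = PrefDivFrom X (init X)

  Div⇒PrefDiv : ∀ {X : LTS Act} {u} → Div X u → PrefDiv X u
  Div⇒PrefDiv {u = u} d = u , [] , sym (++-identityʳ u) , d

  PrefDiv-ε : ∀ {X : LTS Act} → PrefDiv X [] → Div X []
  PrefDiv-ε ([] , _ , _ , d) = d

  PrefDivFrom-extend : ∀ {X : LTS Act} {x u x₁ r r₁} → WeakTr X x u x₁ → r ≡ u ++ r₁ →
                       PrefDivFrom X x₁ r₁ → PrefDivFrom X x r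
  PrefDivFrom-extend {u = u} w refl (u₁ , v , refl , x' , w₁ , d) =
    u ++ u₁ , v , sym (++-assoc u u₁ v) , x' , WeakTr-++ w w₁ , d

  ProperPrefix : List Act → List Act → Set
  ProperPrefix u σ = ∃₂ λ a v → σ ≡ u ++ a ∷ v

  -- The minD condition speaks of take i σ with i < length σ; these are
  -- exactly the proper prefixes.
  take-proper : ∀ i (σ : List Act) → i < length σ → ProperPrefix (take i σ) σ
  take-proper zero    (a ∷ σ) _         = a , σ , refl
  take-proper (suc i) (a ∷ σ) (s≤s lt) =
    let (b , v , e) = take-proper i σ lt in b , v , cong (a ∷_) e

  proper-take : ∀ {u σ : List Act} → ProperPrefix u σ → take (length u) σ ≡ u × length u < length σ
  proper-take {[]}    (a , v , refl) = refl , s≤s z≤n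
  proper-take {b ∷ u} (a , v , refl) =
    let (e , lt) = proper-take {u} (a , v , refl) in cong (b ∷_) e , s≤s lt

  proper-prefix-shrink : ∀ {u₁ v₁ σ : List Act} →
                         ProperPrefix (u₁ ++ v₁) σ → ProperPrefix u₁ σ
  proper-prefix-shrink {u₁} {[]}     (a , v , refl) = a , v , cong (_++ a ∷ v) (++-identityʳ u₁)
  proper-prefix-shrink {u₁} {b ∷ v₁} (a , v , refl) = b , v₁ ++ a ∷ v , ++-assoc u₁ (b ∷ v₁) (a ∷ v)

  All-proper-prefix : ∀ {P : Act → Set} {u σ} → ProperPrefix u σ → All P σ → All P u
  All-proper-prefix {u = u} (_ , _ , refl) = ++⁻ˡ u

  suffix-shorter : ∀ (u : List Act) {r r'} → r ≡ u ++ r' → r' ≢ r → length r' < length r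
  suffix-shorter []      refl ne = ⊥-elim (ne refl)
  suffix-shorter (_ ∷ u) {r' = r'} refl _ = s≤s (length-++-≤ʳ r' {u})

  -- The tester for a word ρ

  TesterΔ : List Act → Label Act → List Act → Set
  TesterΔ r τ       r' = ⊥
  TesterΔ r (act a) r' = r ≡ a ∷ r'

  -- Tester ρ performs exactly the word ρ; its state is the unread suffix,
  -- and its alphabet is everything, so X ∥ Tester ρ reads ρ with X.
  Tester : List Act → LTS Act
  Tester ρ = record { S = List Act ; Sig = λ _ → ⊤ ; Δ = TesterΔ ; init = ρ ; Δ-ok = λ _ _ _ _ → tt }

  Test : List Act → LTS Act → LTS Act
  Test ρ X = hide (par X (Tester ρ)) (λ _ → ⊤)

  Test-silent : ∀ ρ X → Silent (Test ρ X)
  Test-silent ρ X a (_ , visible) = visible tt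

  module _ {ρ : List Act} {X : LTS Act} where

    Test-lift : ∀ {x u x' v} → WeakTr X x u x' → WeakTr (Test ρ X) (x , u ++ v) [] (x' , v)
    Test-lift done        = done
    Test-lift (τstep t w) = τstep (inj₁ (refl , inj₁ (τ₁ t))) (Test-lift w)
    Test-lift (astep {a = a} t w) =
      τstep (inj₁ (refl , inj₂ (a , tt , sync (Δ-ok X _ _ _ t) tt t refl))) (Test-lift w)

    PrefDiv⇒Test-div : PrefDiv X ρ → Div (Test ρ X) []
    PrefDiv⇒Test-div (u , v , refl , x' , w , f , f0 , fs) =
      (x' , v) , Test-lift w , (λ i → f i , v) , cong (_, v) f0 , λ i → inj₁ (refl , inj₁ (τ₁ (fs i)))

    Test-τ-view : ∀ {x r x' r'} → All (Sig X) r → Δ (Test ρ X) (x , r) τ (x' , r') →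
                  (r' ≡ r × Δ X x τ x') ⊎ ∃[ a ] (r ≡ a ∷ r' × Δ X x (act a) x')
    Test-τ-view _        (inj₁ (refl , inj₁ (τ₁ t)))                    = inj₁ (refl , t)
    Test-τ-view _        (inj₁ (refl , inj₁ (τ₂ ())))
    Test-τ-view _        (inj₁ (refl , inj₂ (a , _ , sync _ _ t e)))   = inj₂ (a , e , t)
    Test-τ-view _        (inj₁ (refl , inj₂ (_ , _ , only₁ n _)))      = ⊥-elim (n tt)
    Test-τ-view (Σa ∷ _) (inj₁ (refl , inj₂ (_ , _ , only₂ n refl)))   = ⊥-elim (n Σa)
    Test-τ-view _        (inj₂ (_ , () , _))

    Test-project : ∀ {x r x' r'} → All (Sig X) r → WeakTr (Test ρ X) (x , r) [] (x' , r') →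
                   ∃[ u ] (r ≡ u ++ r' × WeakTr X x u x')
    Test-project al done = [] , refl , done
    Test-project al (τstep t w) with Test-τ-view al t
    ... | inj₁ (refl , t') = let (u , e , w') = Test-project al w in u , e , τstep t' w'
    ... | inj₂ (a , refl , t') with al
    ...   | _ ∷ al' = let (u , e , w') = Test-project al' w in a ∷ u , cong (a ∷_) e , astep t' w'

    Test-τ-fixed : ∀ {x r x' r'} → All (Sig X) r → Δ (Test ρ X) (x , r) τ (x' , r') →
                   r' ≡ r → Δ X x τ x'
    Test-τ-fixed al t e with Test-τ-view al t
    ... | inj₁ (_ , t')        = t'
    ... | inj₂ (_ , refl , _) with e
    ...   | ()

  -- The loop context, detecting alphabet membership

  LoopΔ : Act → ⊤ → Label Act → ⊤ → Set
  LoopΔ a _ τ       _ = ⊥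
  LoopΔ a _ (act b) _ = b ≡ a

  Loop : Act → LTS Act
  Loop a = record { S = ⊤ ; Sig = _≡ a ; Δ = LoopΔ a ; init = tt ; Δ-ok = λ _ _ _ e → e }

  HideA : Act → LTS Act → LTS Act
  HideA a X = hide X (_≡ a)

  -- X ∥ Loop a with a hidden: if a ∉ Σ(X) the loop spins alone, if a ∈ Σ(X)
  -- it can only move jointly with X.
  Starve : Act → LTS Act → LTS Act
  Starve a X = HideA a (par X (Loop a))

  -- The three links used to detect a ∈ Σ(X) through divergence.
  Starve-div : ∀ {a} {X : LTS Act} → ¬ Sig X a → Div (Starve a X) []
  Starve-div {a} {X} na = init (Starve a X) , done , (λ _ → init (Starve a X)) , refl ,
                      λ _ → inj₁ (refl , inj₂ (a , refl , only₂ na refl))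

  Starve-div⇒HideA-div : ∀ {a} {X : LTS Act} → Sig X a → Div (Starve a X) [] → Div (HideA a X) []
  Starve-div⇒HideA-div {a} {X} Σa = Div-ε-map proj₁ refl step
    where
    step : ∀ {s s'} → Δ (Starve a X) s τ s' → Δ (HideA a X) (proj₁ s) τ (proj₁ s')
    step (inj₁ (refl , inj₁ (τ₁ t)))                  = inj₁ (refl , inj₁ t)
    step (inj₁ (refl , inj₁ (τ₂ ())))
    step (inj₁ (refl , inj₂ (b , e , sync _ _ t _)))  = inj₁ (refl , inj₂ (b , e , t))
    step (inj₁ (refl , inj₂ (_ , e , only₁ n _)))     = ⊥-elim (n e)
    step (inj₁ (refl , inj₂ (_ , refl , only₂ n _)))  = ⊥-elim (n Σa)
    step (inj₂ (_ , () , _))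

  HideA-div : ∀ {a} {X : LTS Act} → ¬ Sig X a → Div (HideA a X) [] → Div X []
  HideA-div {a} {X} na = Div-ε-map (λ s → s) refl step
    where
    step : ∀ {s s'} → Δ (HideA a X) s τ s' → Δ X s τ s'
    step (inj₁ (refl , inj₁ t))          = t
    step (inj₁ (refl , inj₂ (_ , refl , t))) = ⊥-elim (na (Δ-ok X _ _ _ t))
    step (inj₂ (_ , () , _))

  module Classical (lem : ExcludedMiddle Level.zero) where

    dne : ∀ {P : Set} → ¬ ¬ P → P
    dne = em⇒dne lem

    -- A system that does not diverge initially reaches a stable state:
    -- otherwise every τ-reachable state has a τ-successor.
    convergent⇒stable : ∀ {L : LTS Act} → ¬ Div L [] → ReachesStable L
    convergent⇒stable {L} nd = dne λ no-stable →
      nd (init L , done , TauDiv-unfold {L} (WeakTr L (init L) []) (step no-stable) done)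
      where
      step : ¬ ReachesStable L → ∀ {s} → WeakTr L (init L) [] s →
             ∃[ s' ] (Δ L s τ s' × WeakTr L (init L) [] s')
      step no-stable {s} w =
        let (s' , t) = dne (λ none → no-stable (s , w , λ s' t → none (s' , t)))
        in s' , t , WeakTr-snocτ w t

    module _ {ρ : List Act} {X : LTS Act} where

      -- A τ-divergence of Test from (x , r) either never moves the tester
      -- (so X diverges at x) or reaches a state with a shorter unread word,
      -- from which we recurse; n bounds the length of r.
      Test-τ-div⇒PrefDivFrom : ∀ n {x r} → length r < n → All (Sig X) r →
                                TauDiv (Test ρ X) (x , r) → PrefDivFrom X x r
      Test-τ-div⇒PrefDivFrom zero    () _ _
      Test-τ-div⇒PrefDivFrom (suc n) {x} {r} (s≤s lt) al p@(f , f0 , fs)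
        with lem {∃[ i ] (proj₂ (f i) ≢ r)}
      ... | no never-moves = [] , r , refl , x , done , X-path
        where
        stays : ∀ i → proj₂ (f i) ≡ r
        stays i = dne (λ ne → never-moves (i , ne))
        X-path : TauDiv X x
        X-path = (λ i → proj₁ (f i)) , cong proj₁ f0 ,
                 λ i → Test-τ-fixed (subst (All (Sig X)) (sym (stays i)) al) (fs i)
                                     (trans (stays (suc i)) (sym (stays i)))
      ... | yes (i , moved) =
        let (u , e , w) = Test-project al (TauDiv-reach p i)
            shorter     = <-≤-trans (suffix-shorter u e moved) lt
            al-rest     = ++⁻ʳ u (subst (All (Sig X)) e al)
        in PrefDivFrom-extend w e (Test-τ-div⇒PrefDivFrom n shorter al-rest (TauDiv-from {Test ρ X} p i))

      Test-div⇒PrefDiv : All (Sig X) ρ → Div (Test ρ X) [] → PrefDiv X ρ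
      Test-div⇒PrefDiv al (s , w , d) =
        let (u , e , w') = Test-project al w
            al-rest      = ++⁻ʳ u (subst (All (Sig X)) e al)
        in PrefDivFrom-extend w' e
             (Test-τ-div⇒PrefDivFrom (suc (length (proj₂ s))) (s≤s ≤-refl) al-rest d)

  module UnderCongruence (lem : ExcludedMiddle Level.zero)
    {ℓ : Level} (_≅_ : LTS Act → LTS Act → Set ℓ) (isC : IsCongruence _≅_)
    (≐⇒≅ : ∀ L L' → L ≐ L' → L ≅ L') (D≇B : ¬ (D Act ≅ B Act)) where

    open Classical lem
    open IsCongruence isC
    open IsEquivalence isEquivalence renaming (sym to ≅-sym; trans to ≅-trans)

    -- Between silent systems, ≅ transfers initial divergence: otherwise
    -- D ≐ Y ≅ X ≐ X ∥ B ≅ Y ∥ B ≐ B.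
    silent-div-transfer : ∀ {X Y} → X ≅ Y → Silent X → Silent Y → Div X [] → Div Y []
    silent-div-transfer {X} {Y} X≅Y eX eY dX = dne λ ndY → D≇B (D≅B ndY)
      where
      D≅B : ¬ Div Y [] → D Act ≅ B Act
      D≅B ndY =
        ≅-trans (≐⇒≅ (D Act) Y D≐Y) (≅-trans (≅-sym X≅Y) (≅-trans (≐⇒≅ X XB X≐XB)
          (≅-trans (par-congˡ (B Act) X≅Y) (≐⇒≅ YB (B Act) YB≐B))))
        where
        XB YB : LTS Act
        XB = par X (B Act)
        YB = par Y (B Act)
        Y-stable : ReachesStable Y
        Y-stable = convergent⇒stable ndY
        D≐Y : D Act ≐ Y
        D≐Y = silent-≐ D-silent eY (mk⇔ (λ _ → Y-stable) (λ _ → D-stable))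
                                   (mk⇔ (λ d → ⊥-elim (D-convergent d)) (λ d → ⊥-elim (ndY d)))
        X≐XB : X ≐ XB
        X≐XB = silent-≐ eX (par-B-silent X eX) par-B-stable (mk⇔ (λ _ → par-B-div X) (λ _ → dX))
        YB≐B : YB ≐ B Act
        YB≐B = silent-≐ (par-B-silent Y eY) B-silent
                        (mk⇔ (λ _ → B-stable) (λ _ → to par-B-stable Y-stable))
                        (mk⇔ (λ _ → B-div) (λ _ → par-B-div Y))

    PrefDiv-transfer : ∀ {X Y ρ} → X ≅ Y → All (Sig Y) ρ → PrefDiv X ρ → PrefDiv Y ρ
    PrefDiv-transfer {X} {Y} {ρ} X≅Y alY pd =
      Test-div⇒PrefDiv alY
        (silent-div-transfer (hide-cong (λ _ → ⊤) (par-congˡ (Tester ρ) X≅Y))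
                             (Test-silent ρ X) (Test-silent ρ Y) (PrefDiv⇒Test-div pd))

    div-transfer : ∀ {X Y} → X ≅ Y → Div X [] → Div Y []
    div-transfer X≅Y d = PrefDiv-ε (PrefDiv-transfer X≅Y [] (Div⇒PrefDiv d))

    -- If L' does not diverge initially, every letter of L is a letter of L':
    -- otherwise Starve a L' diverges, hence so does Starve a L, then
    -- HideA a L, HideA a L', and finally L'.
    alphabet-transfer : ∀ {L L'} → L ≅ L' → ¬ Div L' [] → ∀ {a} → Sig L a → Sig L' a
    alphabet-transfer {L} {L'} L≅L' nd {a} Σa = dne λ na →
      nd (HideA-div na (div-transfer (hide-cong (_≡ a) L≅L')
           (Starve-div⇒HideA-div Σa (div-transfer (≅-sym (hide-cong (_≡ a) (par-congˡ (Loop a) L≅L')))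
             (Starve-div na)))))

    minD-proper-prefix : ∀ {L σ u} → minD L σ → ProperPrefix u σ → ¬ PrefDiv L u
    minD-proper-prefix {L} (_ , minimal) proper (u₁ , v₁ , refl , d) =
      let (take≡u₁ , lt) = proper-take (proper-prefix-shrink {u₁} {v₁} proper)
      in minimal (length u₁) lt (subst (Div L) (sym take≡u₁) d)

    minD-intro : ∀ {L σ} → PrefDiv L σ → (∀ {u} → ProperPrefix u σ → ¬ PrefDiv L u) → minD L σ
    minD-intro {L} {σ} pd no-proper = div pd , λ i lt d → no-proper (take-proper i σ lt) (Div⇒PrefDiv d)
      where
      div : PrefDiv L σ → Div L σ
      div (u , []    , e , d) = subst (Div L) (trans (sym (++-identityʳ u)) (sym e)) d
      div (u , a ∷ v , e , d) = ⊥-elim (no-proper (a , v , e) (Div⇒PrefDiv d))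

    -- A minimal divergence trace of L uses only letters of L'; for σ ≠ []
    -- minimality says L, hence L', does not diverge initially.
    minD-alphabet : ∀ {L L' σ} → L ≅ L' → minD L σ → All (Sig L') σ
    minD-alphabet {σ = []}        _    _ = []
    minD-alphabet {L} {L'} {σ = _ ∷ _} L≅L' ((_ , w , _) , minimal) =
      All.map (alphabet-transfer L≅L' L'-convergent) (WeakTr-alphabet L w)
      where
      L'-convergent : ¬ Div L' []
      L'-convergent d' = minimal 0 (s≤s z≤n) (div-transfer (≅-sym L≅L') d')

    -- Both characterising conditions of minD move from L to L' by
    -- PrefDiv-transfer, in the two directions.
    minD-transfer : ∀ {L L' σ} → L ≅ L' → minD L σ → minD L' σ
    minD-transfer {L} L≅L' m@(d@(_ , w , _) , _) =
      minD-intro (PrefDiv-transfer L≅L' (minD-alphabet L≅L' m) (Div⇒PrefDiv d))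
                 (λ proper pd' → minD-proper-prefix m proper
                    (PrefDiv-transfer (≅-sym L≅L') (All-proper-prefix proper (WeakTr-alphabet L w)) pd'))

theorem6p5 : ExcludedMiddle Level.zero →
    {ℓ : Level} (Act : Set) (_≅_ : LTS Act → LTS Act → Set ℓ) →
    IsCongruence _≅_ →
    (∀ L L' → L ≐ L' → L ≅ L') →
    ¬ (D Act ≅ B Act) →
    Preserves _≅_ minD
theorem6p5 lem Act _≅_ isC ≐⇒≅ D≇B L L' L≅L' σ =
  mk⇔ (minD-transfer L≅L') (minD-transfer (≅-sym L≅L'))
  where
  open Theory.UnderCongruence {Act} lem _≅_ isC ≐⇒≅ D≇B
  open IsEquivalence (IsCongruence.isEquivalence isC) renaming (sym to ≅-sym)
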